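{- Let $G$ be an arbitrary graph, let $\mathcal{H}=\{H_v: v\in V(G)\}$ be a family of graphs, and let $L=G\circ\mathcal{H}$. Then $L$ belongs to $\mathbf{W}_2$ if and only if $H_v$ is a complete graph on at least two vertices for every non-isolated vertex $v$ of $G$, and $H_u$ is a complete graph (on at least one vertex) for every isolated vertex $u$ of $G$.
   Context: Graphs are finite, simple, undirected, with non-empty vertex sets. The corona $G\circ\mathcal{H}$ of $G$ and a family $\mathcal{H}=\{H_v:v\in V(G)\}$ of graphs is the disjoint union of $G$ and all $H_v$, together with additional edges joining each vertex $v\in V(G)$ to all vertices of $H_v$. An independent set is a set of pairwise non-adjacent vertices; a maximum independent set is one of largest size. A graph belongs to $\mathbf{W}_2$ if every two disjoint independent sets are included, respectively, in two disjoint maximum independent sets. -}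

module Defs where

open import Level using (0ℓ)
open import Data.Bool using (Bool; true; false; T)
open import Data.Nat using (ℕ; _≤_)
open import Data.Sum using (_⊎_; inj₁; inj₂)
open import Data.Product using (Σ; Σ-syntax; ∃; ∃-syntax; _×_; _,_)
import Data.Sum.Properties as SumP
import Data.Product.Properties as ProdP
open import Data.List using (List; length; map; concatMap; _++_)
open import Data.List.Membership.Propositional using (_∈_; _∉_)
open import Data.List.Membership.Propositional.Properties
  using (∈-++⁺ˡ; ∈-++⁺ʳ; ∈-map⁺; ∈-concat⁺′)
open import Data.List.Relation.Unary.Unique.Propositional using (Unique)
open import Relation.Nullary using (¬_; Dec; yes; no; does)
open import Relation.Binary.PropositionalEquality using (_≡_; _≢_; refl; sym)
open import Relation.Binary.Definitions using (DecidableEquality)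

record Graph : Set₁ where
  field
    V        : Set
    _≟_      : DecidableEquality V
    vertices : List V
    complete : ∀ x → x ∈ vertices
    some     : V
    adj      : V → V → Bool
    adj-sym  : ∀ x y → adj x y ≡ adj y x
    adj-irr  : ∀ x → adj x x ≡ false

open Graph public

Adj : (G : Graph) → V G → V G → Set
Adj G x y = T (adj G x y)

-- Vertex sets are represented by duplicate-free lists of vertices.

module _ (G : Graph) where

  Independent : List (V G) → Set
  Independent S = Unique S × (∀ {x y} → x ∈ S → y ∈ S → ¬ Adj G x y)

  MaximumIndependent : List (V G) → Set
  MaximumIndependent S =
    Independent S × (∀ T → Independent T → length T ≤ length S)

  _⊆_ : List (V G) → List (V G) → Set
  S ⊆ T = ∀ {x} → x ∈ S → x ∈ T

  Disjoint : List (V G) → List (V G) → Set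
  Disjoint S T = ∀ {x} → x ∈ S → x ∉ T

  InW2 : Set
  InW2 = ∀ S T → Independent S → Independent T → Disjoint S T →
         Σ[ S′ ∈ List (V G) ] Σ[ T′ ∈ List (V G) ]
           MaximumIndependent S′ × MaximumIndependent T′ ×
           S ⊆ S′ × T ⊆ T′ × Disjoint S′ T′

  Isolated : V G → Set
  Isolated v = ∀ w → ¬ Adj G v w

  IsComplete : Set
  IsComplete = ∀ x y → x ≢ y → Adj G x y

  AtLeastTwoVertices : Set
  AtLeastTwoVertices = Σ[ x ∈ V G ] Σ[ y ∈ V G ] x ≢ y

module Corona (G : Graph) (H : V G → Graph) where

  CV : Set
  CV = V G ⊎ Σ (V G) (λ v → V (H v))

  cdec : DecidableEquality CV
  cdec = SumP.≡-dec (_≟_ G) (ProdP.≡-dec (_≟_ G) (λ {v} → _≟_ (H v)))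

  cadj : CV → CV → Bool
  cadj (inj₁ a) (inj₁ b) = adj G a b
  cadj (inj₁ a) (inj₂ (v , x)) = does (_≟_ G a v)
  cadj (inj₂ (v , x)) (inj₁ a) = does (_≟_ G v a)
  cadj (inj₂ (v , x)) (inj₂ (w , y)) with _≟_ G v w
  ... | yes refl = adj (H v) x y
  ... | no _ = false

  cadj-sym : ∀ x y → cadj x y ≡ cadj y x
  cadj-sym (inj₁ a) (inj₁ b) = adj-sym G a b
  cadj-sym (inj₁ a) (inj₂ (v , x)) with _≟_ G a v | _≟_ G v a
  ... | yes _ | yes _ = refl
  ... | no _ | no _ = refl
  ... | yes p | no q = Data.Empty.⊥-elim (q (sym p))
    where import Data.Empty
  ... | no p | yes q = Data.Empty.⊥-elim (p (sym q))
    where import Data.Empty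
  cadj-sym (inj₂ (v , x)) (inj₁ a) with _≟_ G a v | _≟_ G v a
  ... | yes _ | yes _ = refl
  ... | no _ | no _ = refl
  ... | yes p | no q = Data.Empty.⊥-elim (q (sym p))
    where import Data.Empty
  ... | no p | yes q = Data.Empty.⊥-elim (p (sym q))
    where import Data.Empty
  cadj-sym (inj₂ (v , x)) (inj₂ (w , y)) with _≟_ G v w | _≟_ G w v
  ... | yes refl | yes refl = adj-sym (H v) x y
  ... | no _ | no _ = refl
  ... | yes refl | no q = Data.Empty.⊥-elim (q refl)
    where import Data.Empty
  ... | no p | yes refl = Data.Empty.⊥-elim (p refl)
    where import Data.Empty

  cadj-irr : ∀ x → cadj x x ≡ false
  cadj-irr (inj₁ a) = adj-irr G a
  cadj-irr (inj₂ (v , x)) with _≟_ G v v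
  ... | yes refl = adj-irr (H v) x
  ... | no _ = refl

  cvertices : List CV
  cvertices = map inj₁ (vertices G)
           ++ map inj₂ (concatMap (λ v → map (v ,_) (vertices (H v))) (vertices G))

  ccomplete : ∀ x → x ∈ cvertices
  ccomplete (inj₁ a) = ∈-++⁺ˡ (∈-map⁺ inj₁ (complete G a))
  ccomplete (inj₂ (v , x)) =
    ∈-++⁺ʳ (map inj₁ (vertices G))
      (∈-map⁺ inj₂
        (∈-concat⁺′ (∈-map⁺ (v ,_) (complete (H v) x))
                    (∈-map⁺ (λ v → map (v ,_) (vertices (H v))) (complete G v))))

_∘ᶜ_ : (G : Graph) → (V G → Graph) → Graph
G ∘ᶜ H = record
  { V        = CV
  ; _≟_      = cdec
  ; vertices = cvertices
  ; complete = ccomplete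
  ; some     = inj₁ (some G)
  ; adj      = cadj
  ; adj-sym  = cadj-sym
  ; adj-irr  = cadj-irr
  }
  where open Corona G H

-- In G ∘ H every vertex v of G spans a block {v} ∪ V(H v), and the vertices of
-- H v, as well as v itself when v is isolated, have all their neighbours in their
-- own block.
-- If G ∘ H ∈ W₂, extend {v} to a maximum independent set: it meets the block only
-- in v, so two non-adjacent vertices of H v could replace v. If moreover v ~ u and
-- H v = {h}, extend {h} and {u} to disjoint maximum independent sets; the one
-- through u avoids v and h, so h could be added to it.
-- Conversely, when every H v is complete each block is a clique, so independent
-- sets meet each block at most once and every independent transversal of the
-- blocks is maximum. Two disjoint independent sets are extended block by block;
-- where a set misses a block we use a vertex of H v or an isolated v, and the
-- hypotheses provide two distinct such vertices in every block.

module Submission where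

open import Data.Bool using (T)
open import Data.Empty using (⊥-elim)
open import Data.List using (List; []; _∷_; length; map; filter; deduplicate)
open import Data.List.Membership.Propositional using (_∈_; _∉_; find; lose)
open import Data.List.Membership.Propositional.Properties
  using (∈-map⁺; ∈-map⁻; ∈-filter⁺; ∈-filter⁻; ∈-deduplicate⁺)
open import Data.List.Properties using (length-map; filter-notAll)
import Data.List.Relation.Unary.All as All
open import Data.List.Relation.Unary.AllPairs using ([]; _∷_)
open import Data.List.Relation.Unary.Any as Any using (here; there; any?; satisfied)
open import Data.List.Relation.Unary.Unique.Propositional using (Unique)
import Data.List.Relation.Unary.Unique.Propositional.Properties as Unique
import Data.List.Relation.Unary.Unique.DecPropositional.Properties as DecUnique
open import Data.Nat using (suc; _≤_; z≤n)
open import Data.Nat.Properties using (1+n≰n; ≤-trans; module ≤-Reasoning)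
open import Data.Product using (∃-syntax; ∃₂; _×_; _,_; proj₁; proj₂)
open import Data.Sum using (_⊎_; inj₁; inj₂)
open import Data.Unit using (⊤; tt)
open import Function using (_∘_)
open import Function.Bundles using (_⇔_; mk⇔)
open import Relation.Binary.Definitions using (DecidableEquality)
open import Relation.Binary.PropositionalEquality
  using (_≡_; _≢_; refl; sym; trans; cong; subst)
open import Relation.Nullary using (¬_; yes; no; ¬?)
open import Relation.Nullary.Decidable using (dec-true; decidable-stable; T?)
open import Relation.Unary using (Decidable)

open import Defs

module _ {A B : Set} (_≟_ : DecidableEquality B) (f : A → B) where

  length-≤-of-injection : ∀ {xs ys} → Unique xs →
    (∀ {a b} → a ∈ xs → b ∈ xs → f a ≡ f b → a ≡ b) →
    (∀ {a} → a ∈ xs → f a ∈ ys) → length xs ≤ length ys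
  length-≤-of-injection {[]} _ _ _ = z≤n
  length-≤-of-injection {x ∷ xs} {ys} (x∉xs ∷ xs!) inj into = begin-strict
      length xs
    ≤⟨ length-≤-of-injection xs! (λ a∈ b∈ → inj (there a∈) (there b∈)) into-others ⟩
      length (filter (λ b → ¬? (b ≟ f x)) ys)
    <⟨ filter-notAll _ ys (Any.map (λ fx≡b b≢fx → b≢fx (sym fx≡b)) (into (here refl))) ⟩
      length ys
    ∎
    where
      open ≤-Reasoning
      into-others : ∀ {a} → a ∈ xs → f a ∈ filter (λ b → ¬? (b ≟ f x)) ys
      into-others a∈ = ∈-filter⁺ _ (into (there a∈))
        (λ fa≡fx → All.lookup x∉xs a∈ (inj (here refl) (there a∈) (sym fa≡fx)))

differs-from-one : {A : Set} → DecidableEquality A →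
  ∀ {p q} → p ≢ q → ∀ a → p ≢ a ⊎ q ≢ a
differs-from-one _≟_ {p} p≢q a with p ≟ a
... | no p≢a = inj₁ p≢a
... | yes refl = inj₂ (p≢q ∘ sym)

module _ (K : Graph) where

  Adj-sym : ∀ {x y} → Adj K x y → Adj K y x
  Adj-sym {x} {y} = subst T (adj-sym K x y)

  Adj-irrefl : ∀ {x} → ¬ Adj K x x
  Adj-irrefl {x} = subst T (adj-irr K x)

  []-independent : Independent K []
  []-independent = [] , λ ()

  ∷-independent : ∀ {x S} → x ∉ S → (∀ {y} → y ∈ S → ¬ Adj K x y) →
    Independent K S → Independent K (x ∷ S)
  ∷-independent {x} {S} x∉S x≁S (S! , S-indep) =
    All.tabulate (λ y∈S x≡y → x∉S (subst (_∈ S) (sym x≡y) y∈S)) ∷ S! , indep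
    where
      indep : ∀ {a b} → a ∈ x ∷ S → b ∈ x ∷ S → ¬ Adj K a b
      indep (here refl) (here refl) = Adj-irrefl
      indep (here refl) (there b∈) = x≁S b∈
      indep (there a∈) (here refl) = x≁S a∈ ∘ Adj-sym
      indep (there a∈) (there b∈) = S-indep a∈ b∈

  singleton-independent : ∀ x → Independent K (x ∷ [])
  singleton-independent x = ∷-independent (λ ()) (λ ()) []-independent

  filter-independent : ∀ {P : V K → Set} (P? : Decidable P) {S} →
    Independent K S → Independent K (filter P? S)
  filter-independent P? (S! , S-indep) =
    Unique.filter⁺ P? S! ,
    λ a∈ b∈ → S-indep (proj₁ (∈-filter⁻ P? a∈)) (proj₁ (∈-filter⁻ P? b∈))

  independent-≡ : ∀ {X a b} → Independent K X → a ∈ X → b ∈ X →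
    (a ≢ b → Adj K a b) → a ≡ b
  independent-≡ {a = a} {b} (_ , indep) a∈ b∈ adjacent =
    decidable-stable (_≟_ K a b) (λ a≢b → indep a∈ b∈ (adjacent a≢b))

  neighbour-or-isolated : ∀ v → (∃[ u ] Adj K v u) ⊎ Isolated K v
  neighbour-or-isolated v with any? (λ w → T? (adj K v w)) (vertices K)
  ... | yes adjacent = inj₁ (satisfied adjacent)
  ... | no none = inj₂ (λ w v~w → none (lose (complete K w) v~w))

  other-vertex-or-all-equal : ∀ x → (∃[ y ] y ≢ x) ⊎ (∀ y → y ≡ x)
  other-vertex-or-all-equal x with any? (λ y → ¬? (_≟_ K y x)) (vertices K)
  ... | yes other = inj₁ (satisfied other)
  ... | no none = inj₂ λ y →
    decidable-stable (_≟_ K y x) (λ y≢x → none (lose (complete K y) y≢x))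

module CoronaProperties (G : Graph) (H : V G → Graph) where
  open Corona G H

  L : Graph
  L = G ∘ᶜ H

  -- inj₁ v is the hub of block v, and inj₂ (v , x) is the copy of x ∈ V (H v)
  block : CV → V G
  block (inj₁ v) = v
  block (inj₂ (v , _)) = v

  Free : CV → Set
  Free (inj₁ v) = Isolated G v
  Free (inj₂ _) = ⊤

  free-neighbour-in-block : ∀ x z → Free x → Adj L x z → block z ≡ block x
  free-neighbour-in-block (inj₁ v) (inj₁ w) v-isolated v~w = ⊥-elim (v-isolated w v~w)
  free-neighbour-in-block (inj₁ v) (inj₂ (w , _)) _ v~w with _≟_ G v w
  ... | yes v≡w = sym v≡w
  ... | no _ = ⊥-elim v~w
  free-neighbour-in-block (inj₂ (v , _)) (inj₁ w) _ x~w with _≟_ G v w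
  ... | yes v≡w = sym v≡w
  ... | no _ = ⊥-elim x~w
  free-neighbour-in-block (inj₂ (v , _)) (inj₂ (w , _)) _ x~y with _≟_ G v w
  ... | yes v≡w = sym v≡w
  ... | no _ = ⊥-elim x~y

  hub-adjacent : ∀ {v} z → block z ≡ v → z ≢ inj₁ v → Adj L (inj₁ v) z
  hub-adjacent (inj₁ v) refl z≢v = ⊥-elim (z≢v refl)
  hub-adjacent (inj₂ (v , _)) refl _ = subst T (sym (dec-true (_≟_ G v v) refl)) tt

  adj-within-H : ∀ v x y → adj L (inj₂ (v , x)) (inj₂ (v , y)) ≡ adj (H v) x y
  adj-within-H v x y with _≟_ G v v
  ... | yes refl = refl
  ... | no v≢v = ⊥-elim (v≢v refl)

  hub-block-injective : ∀ {X v z} → Independent L X → inj₁ v ∈ X → z ∈ X →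
    block z ≡ v → z ≡ inj₁ v
  hub-block-injective {z = z} X-indep v∈ z∈ refl =
    independent-≡ L X-indep z∈ v∈
      (λ z≢v → Adj-sym L {inj₁ (block z)} {z} (hub-adjacent z refl z≢v))

  maximum-through-hub⇒H-complete : ∀ {S v} → MaximumIndependent L S →
    inj₁ v ∈ S → IsComplete (H v)
  maximum-through-hub⇒H-complete {S} {v} (S-indep , S-max) v∈S x y x≢y =
    decidable-stable (T? (adj (H v) x y)) λ x≁y →
      1+n≰n (≤-trans (S-max (hx ∷ hy ∷ rest) (enlarged-independent x≁y)) S-bound)
    where
      hx hy : CV
      hx = inj₂ (v , x)
      hy = inj₂ (v , y)

      outside? : Decidable (λ z → block z ≢ v)
      outside? z = ¬? (_≟_ G (block z) v)

      rest : List CV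
      rest = filter outside? S

      rest-outside : ∀ {z} → z ∈ rest → block z ≢ v
      rest-outside z∈ = proj₂ (∈-filter⁻ outside? {xs = S} z∈)

      -- every other vertex of the hub's block is adjacent to the hub, hence outside S
      S-bound : length S ≤ suc (length rest)
      S-bound = length-≤-of-injection cdec (λ z → z) (proj₁ S-indep) (λ _ _ e → e) into
        where
          into : ∀ {z} → z ∈ S → z ∈ inj₁ v ∷ rest
          into {z} z∈ with _≟_ G (block z) v
          ... | yes z-in-block = here (hub-block-injective S-indep v∈S z∈ z-in-block)
          ... | no z-outside = there (∈-filter⁺ outside? z∈ z-outside)

      H-vertex-outside : ∀ h {z} → z ∈ rest → ¬ Adj L (inj₂ (v , h)) z
      H-vertex-outside h {z} z∈ h~z =
        rest-outside z∈ (free-neighbour-in-block (inj₂ (v , h)) z tt h~z)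

      enlarged-independent : ¬ Adj (H v) x y → Independent L (hx ∷ hy ∷ rest)
      enlarged-independent x≁y =
        ∷-independent L
          (λ { (here refl) → x≢y refl ; (there hx∈) → rest-outside hx∈ refl })
          (λ { (here refl) → x≁y ∘ subst T (adj-within-H v x y)
             ; (there z∈) → H-vertex-outside x z∈ })
          (∷-independent L (λ hy∈ → rest-outside hy∈ refl) (H-vertex-outside y)
            (filter-independent L outside? S-indep))

  W2⇒H-complete : InW2 L → ∀ v → IsComplete (H v)
  W2⇒H-complete w2 v
    with w2 (inj₁ v ∷ []) [] (singleton-independent L (inj₁ v)) ([]-independent L) (λ _ ())
  ... | _ , _ , S-max , _ , v⊆S , _ , _ =
    maximum-through-hub⇒H-complete S-max (v⊆S (here refl))

  singleton-H-extends : ∀ {T v u h} → (∀ y → y ≡ h) → Adj G v u →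
    Independent L T → inj₁ u ∈ T → inj₂ (v , h) ∉ T →
    Independent L (inj₂ (v , h) ∷ T)
  singleton-H-extends {T} {v} {u} {h} all≡h v~u T-indep u∈T h∉T =
    ∷-independent L h∉T (λ {z} → no-neighbour z) T-indep
    where
      no-neighbour : ∀ z → z ∈ T → ¬ Adj L (inj₂ (v , h)) z
      no-neighbour z z∈ h~z with free-neighbour-in-block (inj₂ (v , h)) z tt h~z
      no-neighbour (inj₁ _) z∈ _ | refl = proj₂ T-indep z∈ u∈T v~u
      no-neighbour (inj₂ (_ , y)) z∈ _ | refl rewrite all≡h y = h∉T z∈

  W2⇒H-nontrivial : InW2 L → ∀ v → ¬ Isolated G v → AtLeastTwoVertices (H v)
  W2⇒H-nontrivial w2 v v-not-isolated with neighbour-or-isolated G v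
  ... | inj₂ v-isolated = ⊥-elim (v-not-isolated v-isolated)
  ... | inj₁ (u , v~u) with other-vertex-or-all-equal (H v) (some (H v))
  ...   | inj₁ (y , y≢h) = y , some (H v) , y≢h
  ...   | inj₂ all≡h
    with w2 (inj₂ (v , some (H v)) ∷ []) (inj₁ u ∷ [])
            (singleton-independent L _) (singleton-independent L _)
            (λ { (here refl) (here ()) })
  ... | _ , _ , _ , (T-indep , T-max) , h⊆S , u⊆T , S∩T=∅ =
    ⊥-elim (1+n≰n (T-max _ (singleton-H-extends all≡h v~u T-indep
      (u⊆T (here refl)) (S∩T=∅ (h⊆S (here refl))))))

  admissible-nonadjacent : ∀ {X a b} → Independent L X →
    a ∈ X ⊎ Free a → b ∈ X ⊎ Free b → block a ≢ block b → ¬ Adj L a b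
  admissible-nonadjacent X-indep (inj₁ a∈) (inj₁ b∈) _ = proj₂ X-indep a∈ b∈
  admissible-nonadjacent {a = a} {b} _ (inj₂ a-free) _ blocks-differ a~b =
    blocks-differ (sym (free-neighbour-in-block a b a-free a~b))
  admissible-nonadjacent {a = a} {b} _ (inj₁ _) (inj₂ b-free) blocks-differ a~b =
    blocks-differ (free-neighbour-in-block b a b-free (Adj-sym L {a} {b} a~b))

  -- the enumeration of G may repeat vertices
  blocks : List (V G)
  blocks = deduplicate (_≟_ G) (vertices G)

  ∈-blocks : ∀ v → v ∈ blocks
  ∈-blocks v = ∈-deduplicate⁺ (_≟_ G) (complete G v)

  transversal-independent : ∀ {X} → Independent L X → (f : V G → CV) →
    (∀ v → block (f v) ≡ v) → (∀ v → f v ∈ X ⊎ Free (f v)) →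
    Independent L (map f blocks)
  transversal-independent X-indep f f-block f-admissible =
    Unique.map⁺ (block-separates ∘ cong block) (DecUnique.deduplicate-! (_≟_ G) (vertices G)) ,
    indep
    where
      block-separates : ∀ {v w} → block (f v) ≡ block (f w) → v ≡ w
      block-separates {v} {w} e = trans (sym (f-block v)) (trans e (f-block w))

      indep : ∀ {a b} → a ∈ map f blocks → b ∈ map f blocks → ¬ Adj L a b
      indep a∈ b∈ with ∈-map⁻ f a∈ | ∈-map⁻ f b∈
      ... | v , _ , refl | w , _ , refl with _≟_ G v w
      ...   | yes refl = Adj-irrefl L {f v}
      ...   | no v≢w = admissible-nonadjacent X-indep (f-admissible v) (f-admissible w)
                         (v≢w ∘ block-separates)

  transversals-disjoint : ∀ {s t : V G → CV} →
    (∀ v → block (s v) ≡ v) → (∀ v → block (t v) ≡ v) → (∀ v → s v ≢ t v) →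
    Disjoint L (map s blocks) (map t blocks)
  transversals-disjoint {s} {t} s-block t-block s≢t a∈s a∈t
    with ∈-map⁻ s a∈s | ∈-map⁻ t a∈t
  ... | v , _ , refl | w , _ , sv≡tw
    with trans (sym (s-block v)) (trans (cong block sv≡tw) (t-block w))
  ... | refl = s≢t v sv≡tw

  meets-block : ∀ X v → (∃[ a ] a ∈ X × block a ≡ v) ⊎ (∀ {z} → z ∈ X → block z ≢ v)
  meets-block X v with any? (λ z → _≟_ G (block z) v) X
  ... | yes meets = inj₁ (find meets)
  ... | no misses = inj₂ (λ z∈ e → misses (lose z∈ e))

  two-free-vertices : (∀ v → ¬ Isolated G v → AtLeastTwoVertices (H v)) → ∀ v →
    ∃₂ λ p q → p ≢ q × block p ≡ v × block q ≡ v × Free p × Free q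
  two-free-vertices H-nontrivial v with neighbour-or-isolated G v
  ... | inj₂ v-isolated = inj₁ v , inj₂ (v , some (H v)) , (λ ()) , refl , refl , v-isolated , tt
  ... | inj₁ (u , v~u) with H-nontrivial v (λ v-isolated → v-isolated u v~u)
  ...   | x , y , x≢y =
    inj₂ (v , x) , inj₂ (v , y) , (λ { refl → x≢y refl }) , refl , refl , tt , tt

  free-vertex-avoiding : (∀ v → ¬ Isolated G v → AtLeastTwoVertices (H v)) → ∀ v a →
    ∃[ p ] p ≢ a × block p ≡ v × Free p
  free-vertex-avoiding H-nontrivial v a
    with two-free-vertices H-nontrivial v
  ... | p , q , p≢q , p-block , q-block , p-free , q-free with differs-from-one cdec p≢q a
  ...   | inj₁ p≢a = p , p≢a , p-block , p-free
  ...   | inj₂ q≢a = q , q≢a , q-block , q-free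

  record Represents (X : List CV) (v : V G) (s : CV) : Set where
    field
      in-block   : block s ≡ v
      admissible : s ∈ X ⊎ Free s
      covers     : ∀ {z} → z ∈ X → block z ≡ v → z ≡ s

  free-represents : ∀ {X v p} → (∀ {z} → z ∈ X → block z ≢ v) →
    block p ≡ v → Free p → Represents X v p
  free-represents X-misses p-block p-free =
    record { in-block = p-block ; admissible = inj₂ p-free
           ; covers = λ z∈ e → ⊥-elim (X-misses z∈ e) }

  represented-⊆ : ∀ {X} {f : V G → CV} → (∀ v → Represents X v (f v)) → _⊆_ L X (map f blocks)
  represented-⊆ {f = f} f-represents {z} z∈ =
    subst (_∈ map f blocks) (sym (Represents.covers (f-represents (block z)) z∈ refl))
      (∈-map⁺ f (∈-blocks (block z)))

  module _ (H-complete : ∀ v → IsComplete (H v)) where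

    block-clique : ∀ a b → block a ≡ block b → a ≢ b → Adj L a b
    block-clique (inj₁ v) b e a≢b = hub-adjacent b (sym e) (a≢b ∘ sym)
    block-clique (inj₂ (v , x)) (inj₁ _) refl a≢b =
      Adj-sym L {inj₁ v} {inj₂ (v , x)} (hub-adjacent (inj₂ (v , x)) refl a≢b)
    block-clique (inj₂ (v , x)) (inj₂ (_ , y)) refl a≢b =
      subst T (sym (adj-within-H v x y)) (H-complete v x y (a≢b ∘ cong (λ h → inj₂ (v , h))))

    independent-block-injective : ∀ {X a b} → Independent L X → a ∈ X → b ∈ X →
      block a ≡ block b → a ≡ b
    independent-block-injective X-indep a∈ b∈ e =
      independent-≡ L X-indep a∈ b∈ (block-clique _ _ e)

    member-represents : ∀ {X a v} → Independent L X → a ∈ X → block a ≡ v → Represents X v a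
    member-represents X-indep a∈ refl = record
      { in-block = refl ; admissible = inj₁ a∈
      ; covers = λ z∈ e → independent-block-injective X-indep z∈ a∈ e }

    transversal-maximum : ∀ {X} → Independent L X → (f : V G → CV) →
      (∀ v → Represents X v (f v)) → MaximumIndependent L (map f blocks)
    transversal-maximum X-indep f f-represents =
      transversal-independent X-indep f (Represents.in-block ∘ f-represents)
        (Represents.admissible ∘ f-represents) ,
      λ Y Y-indep → subst (length Y ≤_) (sym (length-map f blocks))
        (length-≤-of-injection (_≟_ G) block (proj₁ Y-indep)
          (independent-block-injective Y-indep) (λ _ → ∈-blocks _))

    record RepresentativePair (S T : List CV) (v : V G) : Set where
      field
        s t          : CV
        s≢t          : s ≢ t
        s-represents : Represents S v s
        t-represents : Represents T v t

    representatives : (∀ v → ¬ Isolated G v → AtLeastTwoVertices (H v)) →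
      ∀ {S T} → Independent L S → Independent L T → Disjoint L S T → ∀ v →
      RepresentativePair S T v
    representatives H-nontrivial {S} {T} S-indep T-indep S∩T=∅ v
      with meets-block S v | meets-block T v
    ... | inj₁ (a , a∈S , a-block) | inj₁ (b , b∈T , b-block) =
      record { s = a ; t = b ; s≢t = λ { refl → S∩T=∅ a∈S b∈T }
             ; s-represents = member-represents S-indep a∈S a-block
             ; t-represents = member-represents T-indep b∈T b-block }
    ... | inj₁ (a , a∈S , a-block) | inj₂ T-misses =
      let p , p≢a , p-block , p-free = free-vertex-avoiding H-nontrivial v a in
      record { s = a ; t = p ; s≢t = p≢a ∘ sym
             ; s-represents = member-represents S-indep a∈S a-block
             ; t-represents = free-represents T-misses p-block p-free }
    ... | inj₂ S-misses | inj₁ (b , b∈T , b-block) =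
      let p , p≢b , p-block , p-free = free-vertex-avoiding H-nontrivial v b in
      record { s = p ; t = b ; s≢t = p≢b
             ; s-represents = free-represents S-misses p-block p-free
             ; t-represents = member-represents T-indep b∈T b-block }
    ... | inj₂ S-misses | inj₂ T-misses =
      let p , q , p≢q , p-block , q-block , p-free , q-free = two-free-vertices H-nontrivial v in
      record { s = p ; t = q ; s≢t = p≢q
             ; s-represents = free-represents S-misses p-block p-free
             ; t-represents = free-represents T-misses q-block q-free }

    corona-W2 : (∀ v → ¬ Isolated G v → AtLeastTwoVertices (H v)) → InW2 L
    corona-W2 H-nontrivial S T S-indep T-indep S∩T=∅ =
      map s blocks , map t blocks ,
      transversal-maximum S-indep s s-represents ,
      transversal-maximum T-indep t t-represents ,
      represented-⊆ s-represents , represented-⊆ t-represents ,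
      transversals-disjoint (Represents.in-block ∘ s-represents)
        (Represents.in-block ∘ t-represents) s≢t
      where
        open module Pair (v : V G) =
          RepresentativePair (representatives H-nontrivial S-indep T-indep S∩T=∅ v)

open CoronaProperties using (W2⇒H-complete; W2⇒H-nontrivial; corona-W2)

proposition4p3 : (G : Graph) (H : V G → Graph) →
    InW2 (G ∘ᶜ H) ⇔
      (∀ v → (¬ Isolated G v → IsComplete (H v) × AtLeastTwoVertices (H v))
           × (Isolated G v → IsComplete (H v)))
proposition4p3 G H = mk⇔
  (λ w2 v → (λ v-not-isolated →
                 W2⇒H-complete G H w2 v , W2⇒H-nontrivial G H w2 v v-not-isolated)
          , (λ _ → W2⇒H-complete G H w2 v))
  (λ conditions → corona-W2 G H (H-complete conditions) (λ v → proj₂ ∘ proj₁ (conditions v)))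
  where
    H-complete : (∀ v → (¬ Isolated G v → IsComplete (H v) × AtLeastTwoVertices (H v))
                      × (Isolated G v → IsComplete (H v))) → ∀ v → IsComplete (H v)
    H-complete conditions v with neighbour-or-isolated G v
    ... | inj₁ (u , v~u) = proj₁ (proj₁ (conditions v) (λ v-isolated → v-isolated u v~u))
    ... | inj₂ v-isolated = proj₂ (conditions v) v-isolated
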